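{- Let $N$ be a nested set of separations of a graph $G$, and let $P$ and $Q$ be pre-tangles in $G$. Then the set of all oriented separations $(A,B)\in P\cap\vec N$ with $(B,A)\in Q$ is a chain with respect to $\le$.
   Context: A separation of a graph $G$ is an unordered pair $\{A,B\}$ of subsets of $V(G)$ with $A\cup B=V(G)$ and no edge between $A\setminus B$ and $B\setminus A$; its order is $|A\cap B|$. Its orientations are $(A,B),(B,A)$; $\vec N$ is the set of all orientations of elements of $N$. Oriented separations are ordered by $(A,B)\le(C,D)$ iff $A\subseteq C$ and $B\supseteq D$. Separations are nested if they have comparable orientations; a set is nested if pairwise nested. A set $O$ of oriented separations is consistent if there are no $(A,B),(C,D)\in O$ with $\{A,B\}\ne\{C,D\}$ and $(B,A)\le(C,D)$. A pre-tangle in $G$ is a set $P$ which, for some $k\in\mathbb N\cup\{\aleph_0\}$, is a consistent set containing exactly one orientation of each separation of $G$ of order less than $k$. -}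

module Defs where

open import Data.Bool using (Bool; true; false)
open import Data.Nat using (ℕ; _<_)
open import Data.Maybe using (Maybe; just; nothing)
open import Data.List using (List; length)
open import Data.List.Membership.Propositional using (_∈_)
open import Data.Product using (_×_; Σ; ∃)
open import Data.Sum using (_⊎_)
open import Relation.Nullary using (¬_)
open import Relation.Binary.PropositionalEquality using (_≡_)

record Graph : Set₁ where
  field
    V    : Set
    E    : V → V → Set
    symE : ∀ {u v} → E u v → E v u

module _ (G : Graph) where
  open Graph G

  Sub : Set
  Sub = V → Bool

  _∈ˢ_ : V → Sub → Set
  v ∈ˢ A = A v ≡ true

  _∉ˢ_ : V → Sub → Set
  v ∉ˢ A = A v ≡ false

  _⊆_ : Sub → Sub → Set
  A ⊆ B = ∀ v → v ∈ˢ A → v ∈ˢ B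

  _≈_ : Sub → Sub → Set
  A ≈ B = ∀ v → A v ≡ B v

  IsSep : Sub → Sub → Set
  IsSep A B = (∀ v → (v ∈ˢ A) ⊎ (v ∈ˢ B))
            × (∀ u w → u ∈ˢ A → u ∉ˢ B → w ∈ˢ B → w ∉ˢ A → ¬ E u w)

  -- Cardinal bound k ∈ ℕ ∪ {ℵ₀}: just m = m, nothing = ℵ₀.
  Card : Set
  Card = Maybe ℕ

  -- |A ∩ B| < k.  For k = m finite: A ∩ B is covered by a list of length < m;
  -- for k = ℵ₀: A ∩ B is finite (covered by some list).
  OrderLt : Card → Sub → Sub → Set
  OrderLt (just m) A B = Σ (List V) λ xs → (length xs < m) × (∀ v → v ∈ˢ A → v ∈ˢ B → v ∈ xs)
  OrderLt nothing  A B = Σ (List V) λ xs → (∀ v → v ∈ˢ A → v ∈ˢ B → v ∈ xs)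

  _≤ₒ_ : (Sub × Sub) → (Sub × Sub) → Set
  (A Data.Product., B) ≤ₒ (C Data.Product., D) = (A ⊆ C) × (D ⊆ B)

  SameSep : Sub → Sub → Sub → Sub → Set
  SameSep A B C D = ((A ≈ C) × (B ≈ D)) ⊎ ((A ≈ D) × (B ≈ C))

  -- A set of (unordered) separations: N A B means {A,B} ∈ N.
  SepSet : Set₁
  SepSet = Sub → Sub → Set

  OSepSet : Set₁
  OSepSet = Sub → Sub → Set

  _∈⃗_ : (Sub × Sub) → SepSet → Set
  (A Data.Product., B) ∈⃗ N = N A B ⊎ N B A

  IsSepSet : SepSet → Set
  IsSepSet N = ∀ A B → N A B → IsSep A B

  Nested : Sub → Sub → Sub → Sub → Set
  Nested A B C D =
      ((A Data.Product., B) ≤ₒ (C Data.Product., D))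
    ⊎ ((A Data.Product., B) ≤ₒ (D Data.Product., C))
    ⊎ ((B Data.Product., A) ≤ₒ (C Data.Product., D))
    ⊎ ((B Data.Product., A) ≤ₒ (D Data.Product., C))

  IsNestedSet : SepSet → Set
  IsNestedSet N = ∀ A B C D → N A B → N C D → Nested A B C D

  Consistent : OSepSet → Set
  Consistent O = ∀ A B C D → O A B → O C D →
    ¬ ((¬ SameSep A B C D) × ((B Data.Product., A) ≤ₒ (C Data.Product., D)))

  ExactlyOneOrientation : Card → OSepSet → Set
  ExactlyOneOrientation k O =
      (∀ A B → O A B → IsSep A B × OrderLt k A B)
    × (∀ A B → IsSep A B → OrderLt k A B → O A B ⊎ O B A)
    × (∀ A B C D → O A B → O C D → SameSep A B C D → (A ≈ C) × (B ≈ D))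

  IsPreTangle : OSepSet → Set
  IsPreTangle P = Σ Card λ k → Consistent P × ExactlyOneOrientation k P

  IsChain : OSepSet → Set
  IsChain O = ∀ A B C D → O A B → O C D →
    ((A Data.Product., B) ≤ₒ (C Data.Product., D)) ⊎ ((C Data.Product., D) ≤ₒ (A Data.Product., B))

  Between : SepSet → OSepSet → OSepSet → OSepSet
  Between N P Q A B = P A B × ((A Data.Product., B) ∈⃗ N) × Q B A

{-# OPTIONS --safe #-}
-- If two members (A,B), (C,D) of the set are not comparable, nestedness of N
-- leaves only (B,A) ≤ (C,D) or (C,D) ≤ (B,A). In a consistent set that
-- contains exactly one orientation of each separation, (B,A) ≤ (C,D) already
-- forces (A,B) ≤ (C,D); applying this to P in the first case and to Q (which
-- contains (B,A) and (D,C)) in the second gives comparability after all.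
module Submission where

open import Defs
open import Data.Bool using (true; false)
open import Data.Product using (_×_; _,_)
open import Data.Sum using (inj₁; inj₂)
open import Data.Empty using (⊥-elim)
open import Relation.Nullary using (¬_)
open import Relation.Binary.PropositionalEquality using (_≢_; refl; trans; sym)

module _ (G : Graph) where

  OrientsUniquely : OSepSet G → Set
  OrientsUniquely O = ∀ A B C D → O A B → O C D → SameSep G A B C D → (_≈_ G A C) × (_≈_ G B D)

  ≈⇒⊆ : ∀ {A C} → _≈_ G A C → _⊆_ G A C
  ≈⇒⊆ A≈C v v∈A = trans (sym (A≈C v)) v∈A

  ≈⇒≤ₒ : ∀ {A B C D} → _≈_ G A C → _≈_ G B D → _≤ₒ_ G (A , B) (C , D)
  ≈⇒≤ₒ A≈C B≈D = ≈⇒⊆ A≈C , λ v v∈D → trans (B≈D v) v∈D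

  -- Membership is Bool-valued, so inclusion is decidable pointwise.
  ⊆-stable : ∀ {A C} → ¬ ¬ _⊆_ G A C → _⊆_ G A C
  ⊆-stable {C = C} ¬¬A⊆C v v∈A with C v in v∈?C
  ... | true  = refl
  ... | false = ⊥-elim (¬¬A⊆C λ A⊆C → true≢false (trans (sym (A⊆C v v∈A)) v∈?C))
    where
    true≢false : true ≢ false
    true≢false ()

  ≤ₒ-stable : ∀ {A B C D} → ¬ ¬ _≤ₒ_ G (A , B) (C , D) → _≤ₒ_ G (A , B) (C , D)
  ≤ₒ-stable ¬¬AB≤CD =
    ⊆-stable (λ ¬A⊆C → ¬¬AB≤CD λ { (A⊆C , _) → ¬A⊆C A⊆C }) ,
    ⊆-stable (λ ¬D⊆B → ¬¬AB≤CD λ { (_ , D⊆B) → ¬D⊆B D⊆B })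

  ≤ₒ-invert : ∀ {A B C D} → _≤ₒ_ G (A , B) (C , D) → _≤ₒ_ G (D , C) (B , A)
  ≤ₒ-invert (A⊆C , D⊆B) = D⊆B , A⊆C

  consistent-inverse-≤ₒ : ∀ {O} → Consistent G O → OrientsUniquely O →
    ∀ {A B C D} → O A B → O C D → _≤ₒ_ G (B , A) (C , D) → _≤ₒ_ G (A , B) (C , D)
  consistent-inverse-≤ₒ {O} consistent unique {A} {B} {C} {D} oAB oCD BA≤CD =
    ≤ₒ-stable λ AB≰CD →
      consistent A B C D oAB oCD ((λ same → AB≰CD (sameOrientation same)) , BA≤CD)
    where
    sameOrientation : SameSep G A B C D → _≤ₒ_ G (A , B) (C , D)
    sameOrientation same with unique A B C D oAB oCD same
    ... | A≈C , B≈D = ≈⇒≤ₒ A≈C B≈D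

  preTangle-inverse-≤ₒ : ∀ {O} → IsPreTangle G O →
    ∀ {A B C D} → O A B → O C D → _≤ₒ_ G (B , A) (C , D) → _≤ₒ_ G (A , B) (C , D)
  preTangle-inverse-≤ₒ (_ , consistent , _ , _ , unique) =
    consistent-inverse-≤ₒ consistent unique

  Nested-swapˡ : ∀ {A B C D} → Nested G A B C D → Nested G B A C D
  Nested-swapˡ (inj₁ le)               = inj₂ (inj₂ (inj₁ le))
  Nested-swapˡ (inj₂ (inj₁ le))        = inj₂ (inj₂ (inj₂ le))
  Nested-swapˡ (inj₂ (inj₂ (inj₁ le))) = inj₁ le
  Nested-swapˡ (inj₂ (inj₂ (inj₂ le))) = inj₂ (inj₁ le)

  Nested-swapʳ : ∀ {A B C D} → Nested G A B C D → Nested G A B D C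
  Nested-swapʳ (inj₁ le)               = inj₂ (inj₁ le)
  Nested-swapʳ (inj₂ (inj₁ le))        = inj₁ le
  Nested-swapʳ (inj₂ (inj₂ (inj₁ le))) = inj₂ (inj₂ (inj₂ le))
  Nested-swapʳ (inj₂ (inj₂ (inj₂ le))) = inj₂ (inj₂ (inj₁ le))

  nestedSet-orientations : ∀ {N} → IsNestedSet G N → ∀ {A B C D} →
    _∈⃗_ G (A , B) N → _∈⃗_ G (C , D) N → Nested G A B C D
  nestedSet-orientations nested (inj₁ nAB) (inj₁ nCD) = nested _ _ _ _ nAB nCD
  nestedSet-orientations nested (inj₁ nAB) (inj₂ nDC) = Nested-swapʳ (nested _ _ _ _ nAB nDC)
  nestedSet-orientations nested (inj₂ nBA) (inj₁ nCD) = Nested-swapˡ (nested _ _ _ _ nBA nCD)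
  nestedSet-orientations nested (inj₂ nBA) (inj₂ nDC) =
    Nested-swapˡ (Nested-swapʳ (nested _ _ _ _ nBA nDC))

lemma4p2 : (G : Graph) (N : SepSet G) (P Q : OSepSet G) →
    IsSepSet G N → IsNestedSet G N →
    IsPreTangle G P → IsPreTangle G Q →
    IsChain G (Between G N P Q)
-- The argument never uses that the members of N are separations.
lemma4p2 G N P Q _ nested tangleP tangleQ A B C D (pAB , nAB , qBA) (pCD , nCD , qDC)
  with nestedSet-orientations G nested nAB nCD
... | inj₁ AB≤CD               = inj₁ AB≤CD
... | inj₂ (inj₁ AB≤DC)        =
  inj₁ (≤ₒ-invert G (preTangle-inverse-≤ₒ G tangleQ qDC qBA (≤ₒ-invert G AB≤DC)))
... | inj₂ (inj₂ (inj₁ BA≤CD)) = inj₁ (preTangle-inverse-≤ₒ G tangleP pAB pCD BA≤CD)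
... | inj₂ (inj₂ (inj₂ BA≤DC)) = inj₂ (≤ₒ-invert G BA≤DC)
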